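{- Let $S$ be a Kleene relation algebra satisfying the Tarski rule and let $\mathsf{Z}, \mathsf{S} \in S$ be such that $\mathsf{Z}$ is a point, $\mathsf{S}$ is an injective mapping, and $(\mathsf{S}^T)^* \cdot \mathsf{Z} = \top$. Then $\mathsf{S}^* \sqcup (\mathsf{S}^T)^* = \top$.
   Context: A Kleene relation algebra is a structure $(S,\sqcup,\sqcap,\cdot,\overline{\phantom{x}},{}^T,{}^*,\bot,\top,1)$ such that $(S,\sqcup,\sqcap,\overline{\phantom{x}},\bot,\top)$ is a Boolean algebra with order $x \sqsubseteq y \iff x \sqcup y = y$; $(S,\sqcup,\cdot,\bot,1)$ is an idempotent semiring ($\cdot$ associative with two-sided unit $1$, distributing over $\sqcup$, $\bot$ a two-sided zero of $\cdot$); transposition satisfies $(x\sqcup y)^T = x^T \sqcup y^T$, $(x^T)^T = x$, $(x\cdot y)^T = y^T\cdot x^T$ and $(x\cdot y)\sqcap z \sqsubseteq x\cdot(y\sqcap(x^T\cdot z))$; and the star satisfies $1\sqcup y\cdot y^* = y^* = 1 \sqcup y^*\cdot y$, $z\sqcup y\cdot x\sqsubseteq x \Rightarrow y^*\cdot z\sqsubseteq x$, $z \sqcup x\cdot y \sqsubseteq x \Rightarrow z\cdot y^*\sqsubseteq x$. The Tarski rule states $\top\cdot x\cdot\top = \top$ for every $x \neq \bot$. An element $x$ is univalent if $x^T x\sqsubseteq 1$, total if $1\sqsubseteq x x^T$, a mapping if univalent and total, injective if $x x^T\sqsubseteq 1$, surjective if $1\sqsubseteq x^T x$, a vector if $x\cdot\top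 = x$, and a point if it is an injective surjective vector. -}

module Defs where

open import Level using (Level; suc)
open import Relation.Binary.PropositionalEquality using (_≡_)
open import Relation.Nullary using (¬_)

record KleeneRelationAlgebra (ℓ : Level) : Set (suc ℓ) where
  infixr 6 _⊔_
  infixr 7 _⊓_
  infixl 8 _·_
  infix  4 _⊑_
  field
    S    : Set ℓ
    _⊔_  : S → S → S
    _⊓_  : S → S → S
    _·_  : S → S → S
    ¯_   : S → S
    _ᵀ   : S → S
    _⋆   : S → S
    ⊥    : S
    ⊤    : S
    𝟏    : S

  _⊑_ : S → S → Set ℓ
  x ⊑ y = x ⊔ y ≡ y

  field
    ⊔-assoc   : ∀ x y z → (x ⊔ y) ⊔ z ≡ x ⊔ (y ⊔ z)
    ⊔-comm    : ∀ x y → x ⊔ y ≡ y ⊔ x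
    ⊓-assoc   : ∀ x y z → (x ⊓ y) ⊓ z ≡ x ⊓ (y ⊓ z)
    ⊓-comm    : ∀ x y → x ⊓ y ≡ y ⊓ x
    ⊔-absorb  : ∀ x y → x ⊔ (x ⊓ y) ≡ x
    ⊓-absorb  : ∀ x y → x ⊓ (x ⊔ y) ≡ x
    ⊓-distrib : ∀ x y z → x ⊓ (y ⊔ z) ≡ (x ⊓ y) ⊔ (x ⊓ z)
    ⊔-distrib : ∀ x y z → x ⊔ (y ⊓ z) ≡ (x ⊔ y) ⊓ (x ⊔ z)
    ⊔-bot     : ∀ x → x ⊔ ⊥ ≡ x
    ⊓-top     : ∀ x → x ⊓ ⊤ ≡ x
    compl-⊔   : ∀ x → x ⊔ (¯ x) ≡ ⊤
    compl-⊓   : ∀ x → x ⊓ (¯ x) ≡ ⊥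
    ⊔-idem    : ∀ x → x ⊔ x ≡ x
    ·-assoc   : ∀ x y z → (x · y) · z ≡ x · (y · z)
    ·-identityˡ : ∀ x → 𝟏 · x ≡ x
    ·-identityʳ : ∀ x → x · 𝟏 ≡ x
    ·-distribˡ : ∀ x y z → x · (y ⊔ z) ≡ (x · y) ⊔ (x · z)
    ·-distribʳ : ∀ x y z → (x ⊔ y) · z ≡ (x · z) ⊔ (y · z)
    ·-zeroˡ   : ∀ x → ⊥ · x ≡ ⊥
    ·-zeroʳ   : ∀ x → x · ⊥ ≡ ⊥
    ᵀ-⊔       : ∀ x y → (x ⊔ y) ᵀ ≡ (x ᵀ) ⊔ (y ᵀ)
    ᵀ-invol   : ∀ x → (x ᵀ) ᵀ ≡ x
    ᵀ-·       : ∀ x y → (x · y) ᵀ ≡ (y ᵀ) · (x ᵀ)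
    dedekind  : ∀ x y z → (x · y) ⊓ z ⊑ x · (y ⊓ ((x ᵀ) · z))
    star-unfoldˡ : ∀ y → 𝟏 ⊔ (y · (y ⋆)) ≡ y ⋆
    star-unfoldʳ : ∀ y → 𝟏 ⊔ ((y ⋆) · y) ≡ y ⋆
    star-inductˡ : ∀ x y z → z ⊔ (y · x) ⊑ x → (y ⋆) · z ⊑ x
    star-inductʳ : ∀ x y z → z ⊔ (x · y) ⊑ x → z · (y ⋆) ⊑ x

  TarskiRule : Set ℓ
  TarskiRule = ∀ x → ¬ (x ≡ ⊥) → ⊤ · x · ⊤ ≡ ⊤

  univalent : S → Set ℓ
  univalent x = (x ᵀ) · x ⊑ 𝟏

  total : S → Set ℓ
  total x = 𝟏 ⊑ x · (x ᵀ)

  record mapping (x : S) : Set ℓ where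
    field
      isUnivalent : univalent x
      isTotal     : total x

  injective : S → Set ℓ
  injective x = x · (x ᵀ) ⊑ 𝟏

  surjective : S → Set ℓ
  surjective x = 𝟏 ⊑ (x ᵀ) · x

  vector : S → Set ℓ
  vector x = x · ⊤ ≡ x

  record point (x : S) : Set ℓ where
    field
      isInjective  : injective x
      isSurjective : surjective x
      isVector     : vector x

-- Write B = (Sᵀ)⋆.  Since B · Z = ⊤ and Z is injective,
-- ⊤ = (B Z)(B Z)ᵀ = B (Z Zᵀ) Bᵀ ⊑ B Bᵀ, and Bᵀ ⊑ S⋆ because transposition
-- commutes with the star.  Finally, univalence Sᵀ S ⊑ 𝟏 lets one cancel
-- every Sᵀ against an S in a word of B · S⋆, so star induction gives
-- B · S⋆ ⊑ S⋆ ⊔ B.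
module Submission where

open import Defs
open import Level using (Level)
open import Relation.Binary.Bundles using (Preorder)
open import Relation.Binary.Structures using (IsPreorder)
open import Relation.Binary.PropositionalEquality
  using (_≡_; refl; sym; trans; cong; cong₂; isEquivalence)

module KleeneRelationAlgebraProperties {ℓ : Level} (K : KleeneRelationAlgebra ℓ) where
  open KleeneRelationAlgebra K

  ⊑-reflexive : ∀ {x y} → x ≡ y → x ⊑ y
  ⊑-reflexive {x} refl = ⊔-idem x

  ⊑-trans : ∀ {x y z} → x ⊑ y → y ⊑ z → x ⊑ z
  ⊑-trans {x} {y} {z} x⊑y y⊑z = begin
    x ⊔ z        ≡⟨ cong (x ⊔_) y⊑z ⟨
    x ⊔ (y ⊔ z)  ≡⟨ ⊔-assoc x y z ⟨
    (x ⊔ y) ⊔ z  ≡⟨ cong (_⊔ z) x⊑y ⟩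
    y ⊔ z        ≡⟨ y⊑z ⟩
    z            ∎
    where open Relation.Binary.PropositionalEquality.≡-Reasoning

  ⊑-antisym : ∀ {x y} → x ⊑ y → y ⊑ x → x ≡ y
  ⊑-antisym {x} {y} x⊑y y⊑x = trans (sym y⊑x) (trans (⊔-comm y x) x⊑y)

  ⊑-isPreorder : IsPreorder _≡_ _⊑_
  ⊑-isPreorder = record
    { isEquivalence = isEquivalence
    ; reflexive     = ⊑-reflexive
    ; trans         = ⊑-trans
    }

  ⊑-preorder : Preorder ℓ ℓ ℓ
  ⊑-preorder = record { isPreorder = ⊑-isPreorder }

  open import Relation.Binary.Reasoning.Preorder ⊑-preorder

  x⊑x⊔y : ∀ x y → x ⊑ x ⊔ y
  x⊑x⊔y x y = trans (sym (⊔-assoc x x y)) (cong (_⊔ y) (⊔-idem x))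

  y⊑x⊔y : ∀ x y → y ⊑ x ⊔ y
  y⊑x⊔y x y = trans (cong (y ⊔_) (⊔-comm x y)) (trans (x⊑x⊔y y x) (⊔-comm y x))

  ⊔-lub : ∀ {x y z} → x ⊑ z → y ⊑ z → x ⊔ y ⊑ z
  ⊔-lub {x} {y} {z} x⊑z y⊑z = trans (⊔-assoc x y z) (trans (cong (x ⊔_) y⊑z) x⊑z)

  ⊔-monoʳ : ∀ z {x y} → x ⊑ y → z ⊔ x ⊑ z ⊔ y
  ⊔-monoʳ z {x} {y} x⊑y = ⊔-lub (x⊑x⊔y z y) (⊑-trans x⊑y (y⊑x⊔y z y))

  x⊑⊤ : ∀ x → x ⊑ ⊤
  x⊑⊤ x = begin
    x        ≲⟨ x⊑x⊔y x (¯ x) ⟩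
    x ⊔ ¯ x  ≡⟨ compl-⊔ x ⟩
    ⊤        ∎

  ·-monoˡ : ∀ z {x y} → x ⊑ y → x · z ⊑ y · z
  ·-monoˡ z {x} {y} x⊑y = trans (sym (·-distribʳ x y z)) (cong (_· z) x⊑y)

  ·-monoʳ : ∀ z {x y} → x ⊑ y → z · x ⊑ z · y
  ·-monoʳ z {x} {y} x⊑y = trans (sym (·-distribˡ z x y)) (cong (z ·_) x⊑y)

  ᵀ-mono : ∀ {x y} → x ⊑ y → x ᵀ ⊑ y ᵀ
  ᵀ-mono {x} {y} x⊑y = trans (sym (ᵀ-⊔ x y)) (cong _ᵀ x⊑y)

  𝟏ᵀ≡𝟏 : 𝟏 ᵀ ≡ 𝟏
  𝟏ᵀ≡𝟏 = begin-equality
    𝟏 ᵀ                ≡⟨ ·-identityʳ (𝟏 ᵀ) ⟨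
    𝟏 ᵀ · 𝟏            ≡⟨ cong (𝟏 ᵀ ·_) (ᵀ-invol 𝟏) ⟨
    𝟏 ᵀ · (𝟏 ᵀ) ᵀ      ≡⟨ ᵀ-· (𝟏 ᵀ) 𝟏 ⟨
    (𝟏 ᵀ · 𝟏) ᵀ        ≡⟨ cong _ᵀ (·-identityʳ (𝟏 ᵀ)) ⟩
    (𝟏 ᵀ) ᵀ            ≡⟨ ᵀ-invol 𝟏 ⟩
    𝟏                  ∎

  ⊤ᵀ≡⊤ : ⊤ ᵀ ≡ ⊤
  ⊤ᵀ≡⊤ = ⊑-antisym (x⊑⊤ (⊤ ᵀ)) (begin
    ⊤          ≡⟨ ᵀ-invol ⊤ ⟨
    (⊤ ᵀ) ᵀ    ≲⟨ ᵀ-mono (x⊑⊤ (⊤ ᵀ)) ⟩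
    ⊤ ᵀ        ∎)

  ⊤⊑⊤·⊤ : ⊤ ⊑ ⊤ · ⊤
  ⊤⊑⊤·⊤ = begin
    ⊤      ≡⟨ ·-identityʳ ⊤ ⟨
    ⊤ · 𝟏  ≲⟨ ·-monoʳ ⊤ (x⊑⊤ 𝟏) ⟩
    ⊤ · ⊤  ∎

  𝟏⊑x⋆ : ∀ x → 𝟏 ⊑ x ⋆
  𝟏⊑x⋆ x = begin
    𝟏                ≲⟨ x⊑x⊔y 𝟏 (x · x ⋆) ⟩
    𝟏 ⊔ x · x ⋆      ≡⟨ star-unfoldˡ x ⟩
    x ⋆              ∎

  x·x⋆⊑x⋆ : ∀ x → x · x ⋆ ⊑ x ⋆
  x·x⋆⊑x⋆ x = begin
    x · x ⋆          ≲⟨ y⊑x⊔y 𝟏 (x · x ⋆) ⟩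
    𝟏 ⊔ x · x ⋆      ≡⟨ star-unfoldˡ x ⟩
    x ⋆              ∎

  x⋆·x⊑x⋆ : ∀ x → x ⋆ · x ⊑ x ⋆
  x⋆·x⊑x⋆ x = begin
    x ⋆ · x          ≲⟨ y⊑x⊔y 𝟏 (x ⋆ · x) ⟩
    𝟏 ⊔ x ⋆ · x      ≡⟨ star-unfoldʳ x ⟩
    x ⋆              ∎

  x⊑x⋆ : ∀ x → x ⊑ x ⋆
  x⊑x⋆ x = begin
    x                ≡⟨ ·-identityʳ x ⟨
    x · 𝟏            ≲⟨ ·-monoʳ x (𝟏⊑x⋆ x) ⟩
    x · x ⋆          ≲⟨ x·x⋆⊑x⋆ x ⟩
    x ⋆              ∎

  ⋆ᵀ⊑ᵀ⋆ : ∀ x → (x ⋆) ᵀ ⊑ (x ᵀ) ⋆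
  ⋆ᵀ⊑ᵀ⋆ x = begin
    (x ⋆) ᵀ          ≲⟨ ᵀ-mono x⋆⊑B ⟩
    B ᵀ              ≡⟨ ᵀ-invol ((x ᵀ) ⋆) ⟩
    (x ᵀ) ⋆          ∎
    where
    B : S
    B = ((x ᵀ) ⋆) ᵀ

    𝟏⊑B : 𝟏 ⊑ B
    𝟏⊑B = begin
      𝟏              ≡⟨ 𝟏ᵀ≡𝟏 ⟨
      𝟏 ᵀ            ≲⟨ ᵀ-mono (𝟏⊑x⋆ (x ᵀ)) ⟩
      B              ∎

    x·B⊑B : x · B ⊑ B
    x·B⊑B = begin
      x · B                  ≡⟨ cong (_· B) (ᵀ-invol x) ⟨
      (x ᵀ) ᵀ · B            ≡⟨ ᵀ-· ((x ᵀ) ⋆) (x ᵀ) ⟨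
      ((x ᵀ) ⋆ · x ᵀ) ᵀ      ≲⟨ ᵀ-mono (x⋆·x⊑x⋆ (x ᵀ)) ⟩
      B                      ∎

    x⋆⊑B : x ⋆ ⊑ B
    x⋆⊑B = begin
      x ⋆                    ≡⟨ ·-identityʳ (x ⋆) ⟨
      x ⋆ · 𝟏                ≲⟨ star-inductˡ B x 𝟏 (⊔-lub 𝟏⊑B x·B⊑B) ⟩
      B                      ∎

  univalent⇒ᵀ·⋆⊑ᵀ⊔⋆ : ∀ {x} → univalent x → x ᵀ · x ⋆ ⊑ x ᵀ ⊔ x ⋆
  univalent⇒ᵀ·⋆⊑ᵀ⊔⋆ {x} xᵀx⊑𝟏 = begin
    x ᵀ · x ⋆                          ≡⟨ cong (x ᵀ ·_) (star-unfoldˡ x) ⟨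
    x ᵀ · (𝟏 ⊔ x · x ⋆)                ≡⟨ ·-distribˡ (x ᵀ) 𝟏 (x · x ⋆) ⟩
    x ᵀ · 𝟏 ⊔ x ᵀ · (x · x ⋆)          ≡⟨ cong₂ _⊔_ (·-identityʳ (x ᵀ)) (sym (·-assoc (x ᵀ) x (x ⋆))) ⟩
    x ᵀ ⊔ x ᵀ · x · x ⋆                ≲⟨ ⊔-monoʳ (x ᵀ) (·-monoˡ (x ⋆) xᵀx⊑𝟏) ⟩
    x ᵀ ⊔ 𝟏 · x ⋆                      ≡⟨ cong (x ᵀ ⊔_) (·-identityˡ (x ⋆)) ⟩
    x ᵀ ⊔ x ⋆                          ∎

  -- Each application of xᵀ to x⋆ either cancels against an x or lands in (xᵀ)⋆.
  univalent⇒ᵀ⋆·⋆⊑⋆⊔ᵀ⋆ : ∀ {x} → univalent x → (x ᵀ) ⋆ · x ⋆ ⊑ x ⋆ ⊔ (x ᵀ) ⋆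
  univalent⇒ᵀ⋆·⋆⊑⋆⊔ᵀ⋆ {x} xᵀx⊑𝟏 =
    star-inductˡ X (x ᵀ) (x ⋆) (⊔-lub (x⊑x⊔y (x ⋆) ((x ᵀ) ⋆)) xᵀ·X⊑X)
    where
    X : S
    X = x ⋆ ⊔ (x ᵀ) ⋆

    xᵀ·x⋆⊑X : x ᵀ · x ⋆ ⊑ X
    xᵀ·x⋆⊑X = begin
      x ᵀ · x ⋆          ≲⟨ univalent⇒ᵀ·⋆⊑ᵀ⊔⋆ xᵀx⊑𝟏 ⟩
      x ᵀ ⊔ x ⋆          ≲⟨ ⊔-lub (⊑-trans (x⊑x⋆ (x ᵀ)) (y⊑x⊔y (x ⋆) ((x ᵀ) ⋆)))
                                   (x⊑x⊔y (x ⋆) ((x ᵀ) ⋆)) ⟩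
      X                  ∎

    xᵀ·X⊑X : x ᵀ · X ⊑ X
    xᵀ·X⊑X = begin
      x ᵀ · X                              ≡⟨ ·-distribˡ (x ᵀ) (x ⋆) ((x ᵀ) ⋆) ⟩
      x ᵀ · x ⋆ ⊔ x ᵀ · (x ᵀ) ⋆            ≲⟨ ⊔-lub xᵀ·x⋆⊑X
                                                (⊑-trans (x·x⋆⊑x⋆ (x ᵀ)) (y⊑x⊔y (x ⋆) ((x ᵀ) ⋆))) ⟩
      X                                    ∎

  ·injective≡⊤⇒⊤⊑·ᵀ : ∀ {y z} → injective z → y · z ≡ ⊤ → ⊤ ⊑ y · y ᵀ
  ·injective≡⊤⇒⊤⊑·ᵀ {y} {z} zzᵀ⊑𝟏 yz≡⊤ = begin
    ⊤                          ≲⟨ ⊤⊑⊤·⊤ ⟩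
    ⊤ · ⊤                      ≡⟨ cong (⊤ ·_) ⊤ᵀ≡⊤ ⟨
    ⊤ · ⊤ ᵀ                    ≡⟨ cong (λ w → w · w ᵀ) yz≡⊤ ⟨
    y · z · (y · z) ᵀ          ≡⟨ cong (y · z ·_) (ᵀ-· y z) ⟩
    y · z · (z ᵀ · y ᵀ)        ≡⟨ ·-assoc (y · z) (z ᵀ) (y ᵀ) ⟨
    y · z · z ᵀ · y ᵀ          ≡⟨ cong (_· y ᵀ) (·-assoc y z (z ᵀ)) ⟩
    y · (z · z ᵀ) · y ᵀ        ≲⟨ ·-monoˡ (y ᵀ) (·-monoʳ y zzᵀ⊑𝟏) ⟩
    y · 𝟏 · y ᵀ                ≡⟨ cong (_· y ᵀ) (·-identityʳ y) ⟩
    y · y ᵀ                    ∎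

theorem6p4 : {ℓ : Level} (K : KleeneRelationAlgebra ℓ) → let open KleeneRelationAlgebra K in
    TarskiRule → (Z Sc : S) → point Z → mapping Sc → injective Sc →
    ((Sc ᵀ) ⋆) · Z ≡ ⊤ → (Sc ⋆) ⊔ ((Sc ᵀ) ⋆) ≡ ⊤
theorem6p4 K _ Z Sc Z-point Sc-mapping _ B·Z≡⊤ =
  ⊑-antisym (x⊑⊤ (Sc ⋆ ⊔ B)) (begin
    ⊤                  ≲⟨ ·injective≡⊤⇒⊤⊑·ᵀ (point.isInjective Z-point) B·Z≡⊤ ⟩
    B · B ᵀ            ≲⟨ ·-monoʳ B (⋆ᵀ⊑ᵀ⋆ (Sc ᵀ)) ⟩
    B · (Sc ᵀ ᵀ) ⋆     ≡⟨ cong (λ w → B · w ⋆) (ᵀ-invol Sc) ⟩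
    B · Sc ⋆           ≲⟨ univalent⇒ᵀ⋆·⋆⊑⋆⊔ᵀ⋆ (mapping.isUnivalent Sc-mapping) ⟩
    Sc ⋆ ⊔ B           ∎)
  where
  open KleeneRelationAlgebra K
  open KleeneRelationAlgebraProperties K
  open import Relation.Binary.Reasoning.Preorder ⊑-preorder

  B : S
  B = (Sc ᵀ) ⋆
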